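{- Let $m$ be a nonnegative integer, $x$ an indeterminate, and define \[ g_m(u,x):=\sum_{k=0}^m\sum_{i=0}^{m-k} \binom{m+k}{i}\left\{ {m+k-i \atop k} \right\}_{\geq 2}\,\frac{x^i u^{k}}{(1-u)^{m+k+1}} . \] Then, as formal power series in $u$, \[ g_m(u,x) = \sum_{j=0}^\infty \sum_{i=0}^{m}\binom{m+j}{i}\left\{ {m+j-i \atop j} \right\} x^iu^j. \]
   Context: $\left\{ {n \atop k} \right\}$ denotes the Stirling number of the second kind. For integers $n,k\ge0$, $\left\{ {n \atop k} \right\}_{\geq 2}$ is the number of partitions of an $n$-element set into $k$ blocks each having at least two elements (so it is $0$ if $2k>n$), with $\left\{ {0 \atop k} \right\}_{\geq 2}=\delta_{0k}$. $(1-u)^{ -N}$ is expanded as a power series in $u$. -}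

module Defs where

open import Data.Nat using (ℕ; zero; suc; _+_; _*_; _∸_; _≡ᵇ_; _≤ᵇ_)
open import Data.Bool using (if_then_else_; _∧_)
open import Data.Nat.Combinatorics using (_C_)

stirling2 : ℕ → ℕ → ℕ
stirling2 zero    zero    = 1
stirling2 zero    (suc k) = 0
stirling2 (suc n) zero    = 0
stirling2 (suc n) (suc k) = suc k * stirling2 n (suc k) + stirling2 n k

-- Associated Stirling numbers S_{≥2}(n,k): partitions of an n-set into k blocks
-- of size ≥ 2.  Recurrence (element n+1 lies in a block of size ≥3, or in a
-- block of size exactly 2 with one of n partners):
-- S(0,k)=δ_{0k}, S(1,k)=0, S(n+2,k) = k S(n+1,k) + (n+1) S(n,k-1) (0 if k=0).
stirling2≥2 : ℕ → ℕ → ℕ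
stirling2≥2 zero          zero    = 1
stirling2≥2 zero          (suc k) = 0
stirling2≥2 (suc zero)    k       = 0
stirling2≥2 (suc (suc n)) zero    = 0
stirling2≥2 (suc (suc n)) (suc k) =
  suc k * stirling2≥2 (suc n) (suc k) + suc n * stirling2≥2 n k

sumTo : ℕ → (ℕ → ℕ) → ℕ
sumTo zero    f = f zero
sumTo (suc n) f = sumTo n f + f (suc n)

Series : Set
Series = ℕ → ℕ

one : Series
one zero    = 1
one (suc _) = 0

geom : Series
geom _ = 1

_⊛_ : Series → Series → Series
(F ⊛ G) n = sumTo n (λ s → F s * G (n ∸ s))

-- (1-u)^{-N} = (1/(1-u))^N as a formal power series in u
invPow : ℕ → Series
invPow zero    = one
invPow (suc N) = geom ⊛ invPow N

-- formal power series in u with coefficients polynomials in x: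
-- F i j = coefficient of x^i u^j
BiSeries : Set
BiSeries = ℕ → ℕ → ℕ

-- c · x^a · u^b · F(u)
monTimes : ℕ → ℕ → ℕ → Series → BiSeries
monTimes c a b F i j = if (i ≡ᵇ a) ∧ (b ≤ᵇ j) then c * F (j ∸ b) else 0

sumBi : ℕ → (ℕ → BiSeries) → BiSeries
sumBi n F i j = sumTo n (λ t → F t i j)

g : ℕ → BiSeries
g m = sumBi m (λ k → sumBi (m ∸ k) (λ i →
        monTimes (((m + k) C i) * stirling2≥2 (m + k ∸ i) k) i k (invPow (m + k + 1))))

rhs : ℕ → BiSeries
rhs m i j = if i ≤ᵇ m then ((m + j) C i) * stirling2 (m + j ∸ i) j else 0

{-# OPTIONS --safe #-}
-- The coefficient of x^i u^j in g_m is read off directly: the u^d-coefficient of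
-- (1-u)^{-(N+1)} is C(N+d, N), only the summand with x-exponent i contributes, and
-- writing m = i + n the k-th term becomes
--   C(i+n+k, i) S≥2(n+k, k) C(i+n+j, i+n+k) = C(i+n+j, i) · S≥2(n+k, k) C(n+j, n+k).
-- What remains is  Σ_k S≥2(n+k, k) C(n+j, n+k) = S(n+j, j):  a partition of an
-- (n+j)-set into j blocks is its set of n+k non-singleton elements, partitioned into
-- k blocks of size ≥ 2, plus j−k singletons.  This is proved by induction on (n, j)
-- from the two recurrences, Pascal's rule and the absorption identity.
module Submission where

open import Defs
open import Data.Bool using (true; false; if_then_else_)
open import Data.Bool.Properties using (T-≡; ¬-not; if-∧)
open import Data.Empty using (⊥-elim)
open import Data.Nat
open import Data.Nat.Combinatorics
  using (_C_; nCk+nC[k+1]≡[n+1]C[k+1]; nCn≡1; nC1≡n; nCk≡n!/k![n-k]!; k>n⇒nCk≡0; k![n∸k]!∣n!)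
open import Data.Nat.DivMod using (m/n*n≡m)
open import Data.Nat.Properties
open import Algebra.Properties.CommutativeSemigroup +-commutativeSemigroup
  using () renaming (interchange to +-interchange)
open import Data.Nat.Tactic.RingSolver using (solve-∀)
open import Data.Product using (_,_)
open import Data.Sum using (inj₁; inj₂)
open import Function.Bundles using (Equivalence)
open import Relation.Binary.Definitions using (tri<; tri≈; tri>)
open import Relation.Binary.PropositionalEquality
open import Relation.Nullary using (yes; no)
open ≡-Reasoning

sumTo-cong : ∀ n {f h : ℕ → ℕ} → (∀ k → f k ≡ h k) → sumTo n f ≡ sumTo n h
sumTo-cong zero    f≗h = f≗h 0
sumTo-cong (suc n) f≗h = cong₂ _+_ (sumTo-cong n f≗h) (f≗h (suc n))

sumTo-zero : ∀ n {f : ℕ → ℕ} → (∀ k → f k ≡ 0) → sumTo n f ≡ 0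
sumTo-zero zero    f≗0 = f≗0 0
sumTo-zero (suc n) f≗0 = cong₂ _+_ (sumTo-zero n f≗0) (f≗0 (suc n))

sumTo-+ : ∀ n (f h : ℕ → ℕ) → sumTo n (λ k → f k + h k) ≡ sumTo n f + sumTo n h
sumTo-+ zero    f h = refl
sumTo-+ (suc n) f h = trans (cong (_+ (f (suc n) + h (suc n))) (sumTo-+ n f h))
                            (+-interchange (sumTo n f) (sumTo n h) (f (suc n)) (h (suc n)))

sumTo-*ˡ : ∀ n c (f : ℕ → ℕ) → sumTo n (λ k → c * f k) ≡ c * sumTo n f
sumTo-*ˡ zero    c f = refl
sumTo-*ˡ (suc n) c f = trans (cong (_+ c * f (suc n)) (sumTo-*ˡ n c f))
                             (sym (*-distribˡ-+ c (sumTo n f) (f (suc n))))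

sumTo-suc : ∀ n (f : ℕ → ℕ) → sumTo (suc n) f ≡ f 0 + sumTo n (λ k → f (suc k))
sumTo-suc zero    f = refl
sumTo-suc (suc n) f = trans (cong (_+ f (suc (suc n))) (sumTo-suc n f)) (+-assoc (f 0) _ _)

sumTo-truncate : ∀ {b} a (f : ℕ → ℕ) → b ≤ a → (∀ k → b < k → f k ≡ 0) → sumTo a f ≡ sumTo b f
sumTo-truncate zero    f z≤n     _     = refl
sumTo-truncate (suc a) f b≤1+a f>b≗0 with m≤n⇒m<n∨m≡n b≤1+a
... | inj₁ b<1+a = trans (cong₂ _+_ (sumTo-truncate a f (<⇒≤pred b<1+a) f>b≗0) (f>b≗0 (suc a) b<1+a))
                         (+-identityʳ _)
... | inj₂ refl  = refl

≤ᵇ-true : ∀ {m n} → m ≤ n → (m ≤ᵇ n) ≡ true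
≤ᵇ-true m≤n = Equivalence.to T-≡ (≤⇒≤ᵇ m≤n)

≤ᵇ-false : ∀ {m n} → n < m → (m ≤ᵇ n) ≡ false
≤ᵇ-false {m} {n} n<m = ¬-not (λ m≤ᵇn → <⇒≱ n<m (≤ᵇ⇒≤ m n (Equivalence.from T-≡ m≤ᵇn)))

≡ᵇ-refl : ∀ n → (n ≡ᵇ n) ≡ true
≡ᵇ-refl n = Equivalence.to T-≡ (≡⇒≡ᵇ n n refl)

≡ᵇ-false : ∀ {m n} → m ≢ n → (m ≡ᵇ n) ≡ false
≡ᵇ-false {m} {n} m≢n = ¬-not (λ m≡ᵇn → m≢n (≡ᵇ⇒≡ m n (Equivalence.from T-≡ m≡ᵇn)))

if-≤ᵇ : ∀ {a} {X : Set a} m n {x y z : X} →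
        (m ≤ n → x ≡ z) → (n < m → y ≡ z) → (if m ≤ᵇ n then x else y) ≡ z
if-≤ᵇ m n then≡ else≡ with m ≤? n
... | yes m≤n rewrite ≤ᵇ-true m≤n        = then≡ m≤n
... | no  m≰n rewrite ≤ᵇ-false (≰⇒> m≰n) = else≡ (≰⇒> m≰n)

sumTo-select : ∀ n i (h : ℕ → ℕ) →
               sumTo n (λ t → if i ≡ᵇ t then h t else 0) ≡ (if i ≤ᵇ n then h i else 0)
sumTo-select zero    zero    h = refl
sumTo-select zero    (suc i) h = refl
sumTo-select (suc n) i       h rewrite sumTo-select n i h with <-cmp i (suc n)
... | tri< i<1+n i≢1+n _
  rewrite ≤ᵇ-true (≤-pred i<1+n) | ≡ᵇ-false i≢1+n | ≤ᵇ-true (<⇒≤ i<1+n) = +-identityʳ (h i)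
... | tri≈ _ refl _
  rewrite ≤ᵇ-false (n<1+n n) | ≡ᵇ-refl (suc n) | ≤ᵇ-true (≤-refl {suc n}) = refl
... | tri> _ i≢1+n 1+n<i
  rewrite ≤ᵇ-false (<-trans (n<1+n n) 1+n<i) | ≡ᵇ-false i≢1+n | ≤ᵇ-false 1+n<i = refl

C-pascal : ∀ n k → suc n C suc k ≡ n C k + n C suc k
C-pascal n k = sym (nCk+nC[k+1]≡[n+1]C[k+1] n k)

C-absorption : ∀ n k → k * (n C k) + suc k * (n C suc k) ≡ n * (n C k)
C-absorption zero    zero    = refl
C-absorption zero    (suc k) = cong₂ _+_ (*-zeroʳ (suc k)) (*-zeroʳ (suc (suc k)))
C-absorption (suc n) zero    = trans (*-identityˡ _) (trans (nC1≡n (suc n)) (sym (*-identityʳ (suc n))))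
C-absorption (suc n) (suc k) = begin
  suc k * (suc n C suc k) + suc (suc k) * (suc n C suc (suc k))
    ≡⟨ cong₂ (λ p q → suc k * p + suc (suc k) * q) (C-pascal n k) (C-pascal n (suc k)) ⟩
  suc k * (x + y) + suc (suc k) * (y + z)
    ≡⟨ regroup k x y z ⟩
  (k * x + suc k * y) + (suc k * y + suc (suc k) * z) + (x + y)
    ≡⟨ cong (_+ (x + y)) (cong₂ _+_ (C-absorption n k) (C-absorption n (suc k))) ⟩
  n * x + n * y + (x + y)
    ≡⟨ collect n x y ⟩
  suc n * (x + y)
    ≡⟨ cong (suc n *_) (C-pascal n k) ⟨
  suc n * (suc n C suc k) ∎
  where
  x y z : ℕ
  x = n C k
  y = n C suc k
  z = n C suc (suc k)
  regroup : ∀ k x y z → suc k * (x + y) + suc (suc k) * (y + z)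
                      ≡ (k * x + suc k * y) + (suc k * y + suc (suc k) * z) + (x + y)
  regroup = solve-∀
  collect : ∀ n x y → n * x + n * y + (x + y) ≡ suc n * (x + y)
  collect = solve-∀

C-factorial : ∀ {n k} → k ≤ n → (n C k) * (k ! * (n ∸ k) !) ≡ n !
C-factorial {n} {k} k≤n =
  trans (cong (_* (k ! * (n ∸ k) !)) (nCk≡n!/k![n-k]! k≤n)) (m/n*n≡m (k![n∸k]!∣n! k≤n))
  where instance _ = k !* (n ∸ k) !≢0

C-+-factorial : ∀ a b → ((a + b) C a) * (a ! * b !) ≡ (a + b) !
C-+-factorial a b = subst (λ t → ((a + b) C a) * (a ! * t !) ≡ (a + b) !) (m+n∸m≡n a b)
                          (C-factorial (m≤m+n a b))

C-trinomial : ∀ x y z → ((x + y + z) C (x + y)) * ((x + y) C x) ≡ ((x + (y + z)) C x) * ((y + z) C y)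
C-trinomial x y z = *-cancelʳ-≡ _ _ (x ! * y ! * z !) {{x!y!z!≢0}} (begin
  ((x + y + z) C (x + y)) * ((x + y) C x) * (x ! * y ! * z !)
    ≡⟨ reassocˡ ((x + y + z) C (x + y)) ((x + y) C x) (x !) (y !) (z !) ⟩
  ((x + y + z) C (x + y)) * (((x + y) C x) * (x ! * y !) * z !)
    ≡⟨ cong (λ t → ((x + y + z) C (x + y)) * (t * z !)) (C-+-factorial x y) ⟩
  ((x + y + z) C (x + y)) * ((x + y) ! * z !)
    ≡⟨ C-+-factorial (x + y) z ⟩
  (x + y + z) !
    ≡⟨ cong _! (+-assoc x y z) ⟩
  (x + (y + z)) !
    ≡⟨ C-+-factorial x (y + z) ⟨
  ((x + (y + z)) C x) * (x ! * (y + z) !)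
    ≡⟨ cong (λ t → ((x + (y + z)) C x) * (x ! * t)) (C-+-factorial y z) ⟨
  ((x + (y + z)) C x) * (x ! * (((y + z) C y) * (y ! * z !)))
    ≡⟨ reassocʳ ((x + (y + z)) C x) ((y + z) C y) (x !) (y !) (z !) ⟩
  ((x + (y + z)) C x) * ((y + z) C y) * (x ! * y ! * z !) ∎)
  where
  x!y!z!≢0 : NonZero (x ! * y ! * z !)
  x!y!z!≢0 = m*n≢0 _ _ {{x !* y !≢0}} {{z !≢0}}
  reassocˡ : ∀ p q a b c → p * q * (a * b * c) ≡ p * (q * (a * b) * c)
  reassocˡ = solve-∀
  reassocʳ : ∀ p q a b c → p * (a * (q * (b * c))) ≡ p * q * (a * b * c)
  reassocʳ = solve-∀

C-absorption-shifted : ∀ n j k →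
  k * ((n + j) C (n + k)) + suc (n + k) * ((n + j) C (n + suc k)) ≡ j * ((n + j) C (n + k))
C-absorption-shifted n j k = +-cancelˡ-≡ (n * X) _ _ (begin
  n * X + (k * X + suc (n + k) * ((n + j) C (n + suc k)))
    ≡⟨ cong (λ t → n * X + (k * X + suc (n + k) * ((n + j) C t))) (+-suc n k) ⟩
  n * X + (k * X + suc (n + k) * ((n + j) C suc (n + k)))
    ≡⟨ merge n k X _ ⟩
  (n + k) * X + suc (n + k) * ((n + j) C suc (n + k))
    ≡⟨ C-absorption (n + j) (n + k) ⟩
  (n + j) * X
    ≡⟨ *-distribʳ-+ X n j ⟩
  n * X + j * X ∎)
  where
  X : ℕ
  X = (n + j) C (n + k)
  merge : ∀ n k x w → n * x + (k * x + w) ≡ (n + k) * x + w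
  merge = solve-∀

geom-⊛-suc : ∀ (F : Series) n → (geom ⊛ F) (suc n) ≡ F (suc n) + (geom ⊛ F) n
geom-⊛-suc F n = trans (sumTo-suc n (λ s → 1 * F (suc n ∸ s)))
                       (cong (_+ (geom ⊛ F) n) (*-identityˡ (F (suc n))))

invPow-zero : ∀ N → invPow N 0 ≡ 1
invPow-zero zero    = refl
invPow-zero (suc N) = trans (*-identityˡ (invPow N 0)) (invPow-zero N)

invPow-coeff : ∀ N d → invPow (suc N) d ≡ (N + d) C N
invPow-coeff N       zero    = trans (invPow-zero (suc N)) (sym (trans (cong (_C N) (+-identityʳ N)) (nCn≡1 N)))
invPow-coeff zero    (suc d) = trans (geom-⊛-suc one d) (invPow-coeff zero d)
invPow-coeff (suc N) (suc d) = begin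
  invPow (suc (suc N)) (suc d)
    ≡⟨ geom-⊛-suc (invPow (suc N)) d ⟩
  invPow (suc N) (suc d) + invPow (suc (suc N)) d
    ≡⟨ cong₂ _+_ (invPow-coeff N (suc d)) (invPow-coeff (suc N) d) ⟩
  (N + suc d) C N + (suc N + d) C suc N
    ≡⟨ cong (λ t → (N + suc d) C N + t C suc N) (+-suc N d) ⟨
  (N + suc d) C N + (N + suc d) C suc N
    ≡⟨ C-pascal (N + suc d) N ⟨
  (suc N + suc d) C suc N ∎

stirling2-vanish : ∀ {n k} → n < k → stirling2 n k ≡ 0
stirling2-vanish {zero}  {suc k} _         = refl
stirling2-vanish {suc n} {suc k} (s<s n<k) =
  cong₂ _+_ (trans (cong (suc k *_) (stirling2-vanish (m<n⇒m<1+n n<k))) (*-zeroʳ (suc k)))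
            (stirling2-vanish n<k)

stirling2-diag : ∀ n → stirling2 n n ≡ 1
stirling2-diag zero    = refl
stirling2-diag (suc n) =
  cong₂ _+_ (trans (cong (suc n *_) (stirling2-vanish (n<1+n n))) (*-zeroʳ (suc n))) (stirling2-diag n)

stirling2≥2-vanish : ∀ {M k} → M < k + k → stirling2≥2 M k ≡ 0
stirling2≥2-vanish {zero}        {suc k} _          = refl
stirling2≥2-vanish {suc zero}    {k}     _          = refl
stirling2≥2-vanish {suc (suc M)} {suc k} (s<s M+1<) =
  cong₂ _+_ (trans (cong (suc k *_) (stirling2≥2-vanish (m<n⇒m<1+n M+1<))) (*-zeroʳ (suc k)))
            (trans (cong (suc M *_) (stirling2≥2-vanish (≤-pred (subst (suc M <_) (+-suc k k) M+1<))))
                   (*-zeroʳ (suc M)))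

-- Indexed by the excess n of elements over blocks, which keeps the recurrence free of
-- truncated subtraction.
A : ℕ → ℕ → ℕ
A n k = stirling2≥2 (n + k) k

A-vanish : ∀ {n k} → n < k → A n k ≡ 0
A-vanish {n} {k} n<k = stirling2≥2-vanish (+-monoˡ-< k n<k)

A-zero : ∀ n → A (suc n) 0 ≡ 0
A-zero n with n + 0
... | zero  = refl
... | suc _ = refl

A-suc : ∀ n k → A (suc n) (suc k) ≡ suc k * A n (suc k) + suc (n + k) * A n k
A-suc n k rewrite +-suc n k = refl

sumTo-A-suc : ∀ n L (c : ℕ → ℕ) →
  sumTo (suc L) (λ k → A (suc n) k * c k)
  ≡ sumTo (suc L) (λ k → k * A n k * c k) + sumTo L (λ k → suc (n + k) * A n k * c (suc k))
sumTo-A-suc n L c = begin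
  sumTo (suc L) (λ k → A (suc n) k * c k)
    ≡⟨ sumTo-suc L _ ⟩
  A (suc n) 0 * c 0 + sumTo L (λ k → A (suc n) (suc k) * c (suc k))
    ≡⟨ cong₂ _+_ (cong (_* c 0) (A-zero n)) (sumTo-cong L recurrence) ⟩
  sumTo L (λ k → suc k * A n (suc k) * c (suc k) + suc (n + k) * A n k * c (suc k))
    ≡⟨ sumTo-+ L _ _ ⟩
  sumTo L (λ k → suc k * A n (suc k) * c (suc k)) + sumTo L (λ k → suc (n + k) * A n k * c (suc k))
    ≡⟨ cong (_+ sumTo L (λ k → suc (n + k) * A n k * c (suc k))) (sumTo-suc L (λ k → k * A n k * c k)) ⟨
  sumTo (suc L) (λ k → k * A n k * c k) + sumTo L (λ k → suc (n + k) * A n k * c (suc k)) ∎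
  where
  recurrence : ∀ k → A (suc n) (suc k) * c (suc k)
                   ≡ suc k * A n (suc k) * c (suc k) + suc (n + k) * A n k * c (suc k)
  recurrence k = trans (cong (_* c (suc k)) (A-suc n k))
                       (*-distribʳ-+ (c (suc k)) (suc k * A n (suc k)) (suc (n + k) * A n k))

stirling2-by-singletons : ∀ n j → sumTo j (λ k → A n k * ((n + j) C (n + k))) ≡ stirling2 (n + j) j
stirling2-by-singletons zero    zero    = refl
stirling2-by-singletons zero    (suc j) = begin
  sumTo (suc j) (λ k → A 0 k * (suc j C k))
    ≡⟨ sumTo-suc j _ ⟩
  1 + sumTo j (λ k → A 0 (suc k) * (suc j C suc k))
    ≡⟨ cong (1 +_) (sumTo-zero j (λ k → cong (_* (suc j C suc k)) (A-vanish {0} {suc k} z<s))) ⟩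
  1
    ≡⟨ stirling2-diag (suc j) ⟨
  stirling2 (suc j) (suc j) ∎
stirling2-by-singletons (suc n) zero    = cong (_* ((suc n + 0) C (suc n + 0))) (A-zero n)
stirling2-by-singletons (suc n) (suc j) = begin
  sumTo (suc j) (λ k → A (suc n) k * (suc M C suc (n + k)))
    ≡⟨ sumTo-cong (suc j) (λ k → trans (cong (A (suc n) k *_) (C-pascal M (n + k)))
                                        (*-distribˡ-+ (A (suc n) k) _ _)) ⟩
  sumTo (suc j) (λ k → A (suc n) k * (M C (n + k)) + A (suc n) k * (M C suc (n + k)))
    ≡⟨ sumTo-+ (suc j) _ _ ⟩
  sumTo (suc j) (λ k → A (suc n) k * (M C (n + k))) + sumTo (suc j) (λ k → A (suc n) k * (M C suc (n + k)))
    ≡⟨ cong₂ _+_ lower upper ⟩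
  suc j * stirling2 M (suc j) + stirling2 M j ∎
  where
  M : ℕ
  M = n + suc j

  absorb : ∀ k → k * A n k * (M C (n + k)) + suc (n + k) * A n k * (M C (n + suc k))
               ≡ suc j * (A n k * (M C (n + k)))
  absorb k = begin
    k * A n k * (M C (n + k)) + suc (n + k) * A n k * (M C (n + suc k))
      ≡⟨ factor k (A n k) (M C (n + k)) (suc (n + k)) (M C (n + suc k)) ⟩
    A n k * (k * (M C (n + k)) + suc (n + k) * (M C (n + suc k)))
      ≡⟨ cong (A n k *_) (C-absorption-shifted n (suc j) k) ⟩
    A n k * (suc j * (M C (n + k)))
      ≡⟨ swap (A n k) (suc j) (M C (n + k)) ⟩
    suc j * (A n k * (M C (n + k))) ∎
    where
    factor : ∀ k a x c y → k * a * x + c * a * y ≡ a * (k * x + c * y)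
    factor = solve-∀
    swap : ∀ a b c → a * (b * c) ≡ b * (a * c)
    swap = solve-∀

  lower : sumTo (suc j) (λ k → A (suc n) k * (M C (n + k))) ≡ suc j * stirling2 M (suc j)
  lower = begin
    sumTo (suc j) (λ k → A (suc n) k * (M C (n + k)))
      ≡⟨ sumTo-A-suc n j (λ k → M C (n + k)) ⟩
    sumTo (suc j) (λ k → k * A n k * (M C (n + k))) + sumTo j (λ k → suc (n + k) * A n k * (M C (n + suc k)))
      ≡⟨ cong (sumTo (suc j) (λ k → k * A n k * (M C (n + k))) +_)
              (sumTo-truncate (suc j) _ (n≤1+n j) top-vanishes) ⟨
    sumTo (suc j) (λ k → k * A n k * (M C (n + k)))
      + sumTo (suc j) (λ k → suc (n + k) * A n k * (M C (n + suc k)))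
      ≡⟨ sumTo-+ (suc j) _ _ ⟨
    sumTo (suc j) (λ k → k * A n k * (M C (n + k)) + suc (n + k) * A n k * (M C (n + suc k)))
      ≡⟨ sumTo-cong (suc j) absorb ⟩
    sumTo (suc j) (λ k → suc j * (A n k * (M C (n + k))))
      ≡⟨ sumTo-*ˡ (suc j) (suc j) _ ⟩
    suc j * sumTo (suc j) (λ k → A n k * (M C (n + k)))
      ≡⟨ cong (suc j *_) (stirling2-by-singletons n (suc j)) ⟩
    suc j * stirling2 M (suc j) ∎
    where
    top-vanishes : ∀ k → j < k → suc (n + k) * A n k * (M C (n + suc k)) ≡ 0
    top-vanishes k j<k = trans (cong (suc (n + k) * A n k *_) (k>n⇒nCk≡0 (+-monoʳ-< n (s<s j<k))))
                               (*-zeroʳ (suc (n + k) * A n k))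

  upper : sumTo (suc j) (λ k → A (suc n) k * (M C suc (n + k))) ≡ stirling2 M j
  upper = begin
    sumTo (suc j) (λ k → A (suc n) k * (M C suc (n + k)))
      ≡⟨ sumTo-truncate (suc j) _ (n≤1+n j) (λ k j<k →
           trans (cong (A (suc n) k *_) (k>n⇒nCk≡0 (s≤s (+-monoʳ-≤ n j<k)))) (*-zeroʳ (A (suc n) k))) ⟩
    sumTo j (λ k → A (suc n) k * (M C suc (n + k)))
      ≡⟨ cong (λ M′ → sumTo j (λ k → A (suc n) k * (M′ C suc (n + k)))) (+-suc n j) ⟩
    sumTo j (λ k → A (suc n) k * ((suc n + j) C (suc n + k)))
      ≡⟨ stirling2-by-singletons (suc n) j ⟩
    stirling2 (suc n + j) j
      ≡⟨ cong (λ M′ → stirling2 M′ j) (+-suc n j) ⟨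
    stirling2 M j ∎

stirling2-by-singletons-upTo : ∀ n j L → n ≤ L →
  sumTo L (λ k → A n k * ((n + j) C (n + k))) ≡ stirling2 (n + j) j
stirling2-by-singletons-upTo n j L n≤L = begin
  sumTo L f
    ≡⟨ sumTo-truncate (L + j) f (m≤m+n L j) (λ k L<k →
         cong (_* ((n + j) C (n + k))) (A-vanish (≤-<-trans n≤L L<k))) ⟨
  sumTo (L + j) f
    ≡⟨ sumTo-truncate (L + j) f (m≤n+m j L) (λ k j<k →
         trans (cong (A n k *_) (k>n⇒nCk≡0 (+-monoʳ-< n j<k))) (*-zeroʳ (A n k))) ⟩
  sumTo j f
    ≡⟨ stirling2-by-singletons n j ⟩
  stirling2 (n + j) j ∎
  where
  f : ℕ → ℕ
  f k = A n k * ((n + j) C (n + k))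

sumTo-monTimes : ∀ n (c : ℕ → ℕ) b (F : Series) i j →
  sumTo n (λ t → monTimes (c t) t b F i j)
  ≡ (if i ≤ᵇ n then (if b ≤ᵇ j then c i * F (j ∸ b) else 0) else 0)
sumTo-monTimes n c b F i j = trans (sumTo-cong n (λ t → if-∧ (i ≡ᵇ t)))
                                   (sumTo-select n i (λ t → if b ≤ᵇ j then c t * F (j ∸ b) else 0))

m+n+o∸m≡n+o : ∀ m n o → m + n + o ∸ m ≡ n + o
m+n+o∸m≡n+o m n o = trans (cong (_∸ m) (+-assoc m n o)) (m+n∸m≡n m (n + o))

g-term : ∀ i n j k → k ≤ j →
  ((i + n + k) C i) * stirling2≥2 (i + n + k ∸ i) k * invPow (i + n + k + 1) (j ∸ k)
  ≡ ((i + n + j) C i) * (A n k * ((n + j) C (n + k)))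
g-term i n j k k≤j with m≤n⇒∃[o]m+o≡n k≤j
... | d , refl rewrite m+n∸m≡n k d = begin
  ((i + n + k) C i) * stirling2≥2 (i + n + k ∸ i) k * invPow (i + n + k + 1) d
    ≡⟨ cong₂ (λ s p → ((i + n + k) C i) * stirling2≥2 s k * p) (m+n+o∸m≡n+o i n k)
             (trans (cong (λ N → invPow N d) (+-comm (i + n + k) 1)) (invPow-coeff (i + n + k) d)) ⟩
  ((i + n + k) C i) * A n k * ((i + n + k + d) C (i + n + k))
    ≡⟨ rotate ((i + n + k) C i) (A n k) ((i + n + k + d) C (i + n + k)) ⟩
  A n k * (((i + n + k + d) C (i + n + k)) * ((i + n + k) C i))
    ≡⟨ cong (A n k *_) trinomial ⟩
  A n k * (((i + n + (k + d)) C i) * ((n + (k + d)) C (n + k)))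
    ≡⟨ swap (A n k) ((i + n + (k + d)) C i) ((n + (k + d)) C (n + k)) ⟩
  ((i + n + (k + d)) C i) * (A n k * ((n + (k + d)) C (n + k))) ∎
  where
  rotate : ∀ p a q → p * a * q ≡ a * (q * p)
  rotate = solve-∀
  swap : ∀ a b c → a * (b * c) ≡ b * (a * c)
  swap = solve-∀
  trinomial : ((i + n + k + d) C (i + n + k)) * ((i + n + k) C i)
            ≡ ((i + n + (k + d)) C i) * ((n + (k + d)) C (n + k))
  trinomial rewrite +-assoc i n k | +-assoc i n (k + d) | sym (+-assoc n k d) = C-trinomial i (n + k) d

g-coefficient : ∀ i n j →
  g (i + n) i j ≡ ((i + n + j) C i) * sumTo (i + n) (λ k → A n k * ((n + j) C (n + k)))
g-coefficient i n j = begin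
  g (i + n) i j
    ≡⟨ sumTo-cong (i + n) (λ k →
         trans (sumTo-monTimes (i + n ∸ k) (c k) k (invPow (i + n + k + 1)) i j) (term k)) ⟩
  sumTo (i + n) (λ k → ((i + n + j) C i) * (A n k * ((n + j) C (n + k))))
    ≡⟨ sumTo-*ˡ (i + n) ((i + n + j) C i) _ ⟩
  ((i + n + j) C i) * sumTo (i + n) (λ k → A n k * ((n + j) C (n + k))) ∎
  where
  c : ℕ → ℕ → ℕ
  c k t = ((i + n + k) C t) * stirling2≥2 (i + n + k ∸ t) k

  term : ∀ k →
    (if i ≤ᵇ i + n ∸ k then (if k ≤ᵇ j then c k i * invPow (i + n + k + 1) (j ∸ k) else 0) else 0)
             ≡ ((i + n + j) C i) * (A n k * ((n + j) C (n + k)))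
  term k = if-≤ᵇ i (i + n ∸ k)
    (λ _ → if-≤ᵇ k j (g-term i n j k) (λ j<k → sym (zero-by-C (k>n⇒nCk≡0 (+-monoʳ-< n j<k)))))
    (λ i+n∸k<i → sym (zero-by-A (A-vanish (n<k i+n∸k<i))))
    where
    n<k : i + n ∸ k < i → n < k
    n<k i+n∸k<i = ≰⇒> (λ k≤n →
      <⇒≱ i+n∸k<i (subst (i ≤_) (sym (+-∸-assoc i k≤n)) (m≤m+n i (n ∸ k))))
    zero-by-A : A n k ≡ 0 → ((i + n + j) C i) * (A n k * ((n + j) C (n + k))) ≡ 0
    zero-by-A eq rewrite eq = *-zeroʳ ((i + n + j) C i)
    zero-by-C : (n + j) C (n + k) ≡ 0 → ((i + n + j) C i) * (A n k * ((n + j) C (n + k))) ≡ 0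
    zero-by-C eq rewrite eq | *-zeroʳ (A n k) = *-zeroʳ ((i + n + j) C i)

g≡rhs : ∀ i n j → g (i + n) i j ≡ rhs (i + n) i j
g≡rhs i n j = begin
  g (i + n) i j
    ≡⟨ g-coefficient i n j ⟩
  ((i + n + j) C i) * sumTo (i + n) (λ k → A n k * ((n + j) C (n + k)))
    ≡⟨ cong (((i + n + j) C i) *_) (stirling2-by-singletons-upTo n j (i + n) (m≤n+m n i)) ⟩
  ((i + n + j) C i) * stirling2 (n + j) j
    ≡⟨ cong (λ N → ((i + n + j) C i) * stirling2 N j) (m+n+o∸m≡n+o i n j) ⟨
  ((i + n + j) C i) * stirling2 (i + n + j ∸ i) j
    ≡⟨ cong (λ b → if b then ((i + n + j) C i) * stirling2 (i + n + j ∸ i) j else 0)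
            (≤ᵇ-true (m≤m+n i n)) ⟨
  rhs (i + n) i j ∎

g-vanish : ∀ {m i} j → m < i → g m i j ≡ 0
g-vanish {m} {i} j m<i = sumTo-zero m (λ k →
  trans (sumTo-monTimes (m ∸ k) (λ t → ((m + k) C t) * stirling2≥2 (m + k ∸ t) k) k
                        (invPow (m + k + 1)) i j)
        (if-≤ᵇ i (m ∸ k) (λ i≤m∸k → ⊥-elim (<⇒≱ m<i (≤-trans i≤m∸k (m∸n≤m m k))))
                         (λ _ → refl)))

rhs-vanish : ∀ {m i} j → m < i → rhs m i j ≡ 0
rhs-vanish {m} {i} j m<i =
  cong (λ b → if b then ((m + j) C i) * stirling2 (m + j ∸ i) j else 0) (≤ᵇ-false m<i)

lemma2p2 : (m i j : ℕ) → g m i j ≡ rhs m i j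
lemma2p2 m i j with i ≤? m
... | yes i≤m = subst (λ m → g m i j ≡ rhs m i j) (m+[n∸m]≡n i≤m) (g≡rhs i (m ∸ i) j)
... | no  i≰m = trans (g-vanish j (≰⇒> i≰m)) (sym (rhs-vanish j (≰⇒> i≰m)))
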